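{- Let $K$ be a field of characteristic not equal to $2$, let $f(z)=z^2+c\in K[z]$ with $0$ not periodic and $f^r(0)=-f(0)$ for a minimal $r>1$; assume $r\ge3$. Let $x_0\in K$ not lie in the forward orbit $\{f^i(0):i\ge0\}$ of $0$, and fix a choice of $\sqrt2\in\overline K$. For a labeling of the preimage tree of $x_0$ and a word $y$, let $E_y=\prod_{w'\in\{a,b\}^{r-2}}[yw'a]$. Suppose the labeling satisfies, for every word $x$, $$E_{xaa}E_{xab}=[xba],\qquad E_{xba}E_{xbb}=[xaa],$$ $$\frac{E_{xaa}+E_{xab}}{E_{xbb}}=\frac{E_{xab}-E_{xaa}}{E_{xba}}=\frac{E_{xba}+E_{xbb}}{E_{xab}}=\frac{E_{xbb}-E_{xba}}{E_{xaa}}=\sqrt2$$ (such a labeling exists). Then for every node $x$ and every $\sigma\in G_\infty=\mathrm{Gal}(K_\infty/K)$, $$P^a_{r,1}(\sigma,x)=P^b_{r,1}(\sigma,x)=0\quad\text{and}\quad\sigma(\sqrt2)=(-1)^{R_{r,1}(\sigma,x)}\sqrt2.$$ In particular, the image of $G_\infty$ in $\mathrm{Aut}(T_\infty)$ induced by this labeling is contained in $\tilde M_{r,1,\infty}$. Furthermore, if $\sqrt2\in K$, then this image is contained in $\tilde B_{r,1,\infty}$.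
   Context: Labeling: assign to each word $w$ in $\{a,b\}$ of length $n$ a point $[w]\in f^{ -n}(x_0)\subset\overline K$ with $[\,]=x_0$, bijectively on each level, such that $[wa],[wb]=-[wa]$ are the two roots of $f(z)=[w]$. $K_\infty=\bigcup_nK(f^{ -n}(x_0))$; $\sigma\in G_\infty$ acts on words by $[\sigma(w)]=\sigma([w])$, giving $G_\infty\to\mathrm{Aut}(T_\infty)$ ($T_\infty$ the binary rooted tree of words). $\mathrm{Par}(\sigma,x)\in\mathbb{Z}/2\mathbb{Z}$ is $0$ if $\sigma(xa)=\sigma(x)a$, $1$ otherwise. $P^a_{r,1}(\sigma,x)=\mathrm{Par}(\sigma,xb)+\sum_{w\in\{a,b\}^{r-1}}\mathrm{Par}(\sigma,xaw)$, $P^b_{r,1}(\sigma,x)=\mathrm{Par}(\sigma,xa)+\sum_{w\in\{a,b\}^{r-1}}\mathrm{Par}(\sigma,xbw)$ (mod 2); $M_{r,1,\infty}$ = set of $\sigma$ with all these values over all nodes equal (common value $P_{r,1}(\sigma)$), $B_{r,1,\infty}=\{P_{r,1}=0\}$. $R_{r,1}(\sigma,x)=\mathrm{Par}(\sigma,xa)\mathrm{Par}(\sigma,xb)+\sum_{w\in\{a,b\}^{r-2}}(\mathrm{Par}(\sigma,xabw)+\mathrm{Par}(\sigma,xbbw))$ mod 2. $\tilde M_{r,1,\infty}=\{\sigma\in B_{r,1,\infty}:R_{r,1}(\sigma,x)\text{ independent of }x\}$ with common value $R_{r,1}(\sigma)$; $\tilde B_{r,1,\infty}=\{\sigma\in\tilde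 M_{r,1,\infty}:R_{r,1}(\sigma)=0\}$. -}

module Defs where

open import Level using (Level; _⊔_)
open import Algebra.Bundles using (CommutativeRing)
open import Data.Nat using (ℕ; zero; suc; _∸_)
open import Data.Bool using (Bool; true; false; not; _xor_; _∧_)
open import Data.List using (List; []; _∷_; [_]; _++_; length; map; foldr; concatMap)
open import Data.List.Relation.Unary.All using (All)
open import Data.List.Properties using (≡-dec)
open import Data.Product using (Σ; ∃; _×_)
open import Relation.Nullary using (¬_; Dec; yes; no)
open import Relation.Nullary.Decidable using (⌊_⌋)
open import Relation.Binary.PropositionalEquality using (_≡_; refl)

-- Words over {a,b} (nodes of the binary rooted tree T∞)

data Letter : Set where
  a b : Letter

Word : Set
Word = List Letter

_≟L_ : (x y : Letter) → Dec (x ≡ y)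
a ≟L a = yes refl
a ≟L b = no λ ()
b ≟L a = no λ ()
b ≟L b = yes refl

_≟W_ : (v w : Word) → Dec (v ≡ w)
_≟W_ = ≡-dec _≟L_

words : ℕ → List Word
words zero = [ [] ]
words (suc n) = concatMap (λ w → (a ∷ w) ∷ (b ∷ w) ∷ []) (words n)

-- sum in ℤ/2ℤ, with Bool encoding ℤ/2ℤ (false = 0, true = 1)
xorSum : List Bool → Bool
xorSum = foldr _xor_ false

Par : (Word → Word) → Word → Bool
Par act x = not ⌊ act (x ++ [ a ]) ≟W (act x ++ [ a ]) ⌋

Pa : ℕ → (Word → Word) → Word → Bool
Pa r act x = Par act (x ++ [ b ]) xor xorSum (map (λ w → Par act (x ++ a ∷ w)) (words (r ∸ 1)))

Pb : ℕ → (Word → Word) → Word → Bool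
Pb r act x = Par act (x ++ [ a ]) xor xorSum (map (λ w → Par act (x ++ b ∷ w)) (words (r ∸ 1)))

Rr : ℕ → (Word → Word) → Word → Bool
Rr r act x =
  (Par act (x ++ [ a ]) ∧ Par act (x ++ [ b ]))
  xor xorSum (map (λ w → Par act (x ++ a ∷ b ∷ w) xor Par act (x ++ b ∷ b ∷ w)) (words (r ∸ 2)))

InM : ℕ → (Word → Word) → Set
InM r act = ∃ λ v → ∀ x → Pa r act x ≡ v × Pb r act x ≡ v

InB : ℕ → (Word → Word) → Set
InB r act = ∀ x → Pa r act x ≡ false × Pb r act x ≡ false

InMt : ℕ → (Word → Word) → Set
InMt r act = InB r act × ∃ λ u → ∀ x → Rr r act x ≡ u

InBt : ℕ → (Word → Word) → Set
InBt r act = InB r act × (∀ x → Rr r act x ≡ false)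

-- Field theory inside a commutative ring L (playing the role of K̄)

module FT {c ℓ : Level} (L : CommutativeRing c ℓ) where
  open CommutativeRing L

  IsField : Set (c ⊔ ℓ)
  IsField = (¬ (1# ≈ 0#)) × (∀ x → ¬ (x ≈ 0#) → ∃ λ y → x * y ≈ 1#)

  record Subfield : Set (Level.suc (c ⊔ ℓ)) where
    field
      InK   : Carrier → Set (c ⊔ ℓ)
      resp  : ∀ {x y} → x ≈ y → InK x → InK y
      zero∈ : InK 0#
      one∈  : InK 1#
      +∈    : ∀ {x y} → InK x → InK y → InK (x + y)
      *∈    : ∀ {x y} → InK x → InK y → InK (x * y)
      -∈    : ∀ {x} → InK x → InK (- x)
      inv∈  : ∀ {x y} → InK x → x * y ≈ 1# → InK y

  -- value at z of the monic polynomial z^n + c_{n-1} z^{n-1} + … + c_0,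
  -- where cs = c_0 ∷ … ∷ c_{n-1}
  evalMonic : List Carrier → Carrier → Carrier
  evalMonic []       z = 1#
  evalMonic (d ∷ cs) z = d + z * evalMonic cs z

  IsAlgClosureOf : Subfield → Set (c ⊔ ℓ)
  IsAlgClosureOf K =
    (∀ (d : Carrier) (cs : List Carrier) → ∃ λ z → evalMonic (d ∷ cs) z ≈ 0#)
    × (∀ x → ∃ λ cs → All (Subfield.InK K) cs × evalMonic cs x ≈ 0#)

  fc : Carrier → Carrier → Carrier
  fc cc z = z * z + cc

  iter : (Carrier → Carrier) → ℕ → Carrier → Carrier
  iter g zero    z = z
  iter g (suc n) z = g (iter g n z)

  record IsLabeling (cc x0 : Carrier) (lab : Word → Carrier) : Set (c ⊔ ℓ) where
    field
      root    : lab [] ≈ x0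
      child-a : ∀ w → fc cc (lab (w ++ [ a ])) ≈ lab w
      child-b : ∀ w → lab (w ++ [ b ]) ≈ - lab (w ++ [ a ])
      inj     : ∀ v w → length v ≡ length w → lab v ≈ lab w → v ≡ w
      surj    : ∀ n z → iter (fc cc) n z ≈ x0 → ∃ λ w → length w ≡ n × lab w ≈ z

  data InK∞ (K : Subfield) (lab : Word → Carrier) : Carrier → Set (c ⊔ ℓ) where
    base  : ∀ {x} → Subfield.InK K x → InK∞ K lab x
    label : ∀ w → InK∞ K lab (lab w)
    resp  : ∀ {x y} → x ≈ y → InK∞ K lab x → InK∞ K lab y
    add   : ∀ {x y} → InK∞ K lab x → InK∞ K lab y → InK∞ K lab (x + y)
    mul   : ∀ {x y} → InK∞ K lab x → InK∞ K lab y → InK∞ K lab (x * y)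
    neg   : ∀ {x} → InK∞ K lab x → InK∞ K lab (- x)
    inv   : ∀ {x y} → InK∞ K lab x → x * y ≈ 1# → InK∞ K lab y

  record IsGalElt (K : Subfield) (lab : Word → Carrier)
                  (σ : (x : Carrier) → InK∞ K lab x → Carrier) : Set (c ⊔ ℓ) where
    field
      cong   : ∀ x y p q → x ≈ y → σ x p ≈ σ y q
      closed : ∀ x p → InK∞ K lab (σ x p)
      hom-+  : ∀ x y p q pq → σ (x + y) pq ≈ σ x p + σ y q
      hom-*  : ∀ x y p q pq → σ (x * y) pq ≈ σ x p * σ y q
      hom-1  : ∀ p → σ 1# p ≈ 1#
      injective  : ∀ x y p q → σ x p ≈ σ y q → x ≈ y
      surjective : ∀ y → InK∞ K lab y → ∃ λ x → Σ (InK∞ K lab x) λ p → σ x p ≈ y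
      fixK   : ∀ x (k : Subfield.InK K x) p → σ x p ≈ x

  Induces : (K : Subfield) (lab : Word → Carrier)
            (σ : (x : Carrier) → InK∞ K lab x → Carrier) → (Word → Word) → Set ℓ
  Induces K lab σ act = ∀ w → length (act w) ≡ length w × lab (act w) ≈ σ (lab w) (label w)

  E : ℕ → (Word → Carrier) → Word → Carrier
  E r lab y = foldr _*_ 1# (map (λ w' → lab (y ++ w' ++ [ a ])) (words (r ∸ 2)))

  -- the hypotheses on the labeling, for the node x (with s = √2);
  -- the quotient identities (u/v = s) are written as u = s·v
  LabelHyp : ℕ → (Word → Carrier) → Carrier → Word → Set ℓ
  LabelHyp r lab s x =
    (Eaa * Eab ≈ lab (x ++ b ∷ a ∷ []))
    × (Eba * Ebb ≈ lab (x ++ a ∷ a ∷ []))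
    × (Eaa + Eab ≈ s * Ebb)
    × (Eab - Eaa ≈ s * Eba)
    × (Eba + Ebb ≈ s * Eab)
    × (Ebb - Eba ≈ s * Eaa)
    where
      Eaa = E r lab (x ++ a ∷ a ∷ [])
      Eab = E r lab (x ++ a ∷ b ∷ [])
      Eba = E r lab (x ++ b ∷ a ∷ [])
      Ebb = E r lab (x ++ b ∷ b ∷ [])

  signed : Bool → Carrier → Carrier
  signed false s = s
  signed true  s = - s

-- Write the Galois action on the tree as signs: σ[w l] = ±[σ(w) l], the sign being
-- (-1)^Par(σ,w).  Then σ(E_y) = (-1)^S(y) E_{σ(y)}, where S(y) is the sum of the
-- parities on the r-2 levels of the subtree below y.  Applying σ to
-- E_{xia} E_{xib} = [x ī a] (ī the other letter) gives Par(σ,xī) = S(xia) + S(xib),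
-- and P^a, P^b are sums of exactly these two quantities, hence vanish.  Applying σ to
-- √2 E_{xbb} = E_{xaa} + E_{xab} and using the four quotient identities at σ(x) to
-- rewrite the signed sum on the right identifies σ(√2)/√2 with (-1)^R(σ,x).  Signs can
-- be compared throughout because no label vanishes, x0 not being in the orbit of 0.
module Submission where

open import Defs
open import Level using (Level)
open import Algebra.Bundles using (CommutativeRing; CommutativeMonoid)
open import Data.Bool using (Bool; true; false; _xor_; _∧_)
open import Data.Bool.Properties using (xor-∧-commutativeRing; xor-same; xor-comm; xor-assoc)
open import Data.List using (List; []; _∷_; [_]; _++_; _∷ʳ_; length; map; foldr; concatMap)
open import Data.List.Properties using (++-assoc; ++-identityʳ; length-++)
open import Data.Nat using (ℕ; zero; suc; _≤_; _<_; s≤s)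
import Data.Nat as Nat
open import Data.Product using (Σ; _×_; _,_; proj₁; proj₂)
open import Data.Empty using (⊥-elim)
open import Relation.Nullary using (¬_; yes; no)
open import Relation.Binary.PropositionalEquality as ≡ using (_≡_)

∷ʳ-++ : ∀ (x : Word) l w → x ∷ʳ l ++ w ≡ x ++ l ∷ w
∷ʳ-++ x l w = ++-assoc x [ l ] w

∷ʳ-∷ʳ-++ : ∀ (x : Word) i j w → x ∷ʳ i ∷ʳ j ++ w ≡ x ++ i ∷ j ∷ w
∷ʳ-∷ʳ-++ x i j w = ≡.trans (∷ʳ-++ (x ∷ʳ i) j w) (∷ʳ-++ x i (j ∷ w))

flipLetter : Letter → Letter
flipLetter a = b
flipLetter b = a

flipIf : Bool → Letter → Letter
flipIf false l = l
flipIf true  l = flipLetter l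

flipIf-flipLetter : ∀ p l → flipIf p (flipLetter l) ≡ flipLetter (flipIf p l)
flipIf-flipLetter false l = ≡.refl
flipIf-flipLetter true  l = ≡.refl

module TreeFold {c ℓ} (M : CommutativeMonoid c ℓ) where
  open CommutativeMonoid M
  open import Algebra.Properties.CommutativeSemigroup commutativeSemigroup using (interchange)

  fold : List Carrier → Carrier
  fold = foldr _∙_ ε

  treeFold : ℕ → (Word → Carrier) → Word → Carrier
  treeFold zero    g y = g y
  treeFold (suc n) g y = treeFold n g (y ∷ʳ a) ∙ treeFold n g (y ∷ʳ b)

  fold-map-∙ : ∀ {A : Set} (g h : A → Carrier) xs →
               fold (map (λ x → g x ∙ h x) xs) ≈ fold (map g xs) ∙ fold (map h xs)
  fold-map-∙ g h []       = sym (identityˡ ε)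
  fold-map-∙ g h (x ∷ xs) = trans (∙-congˡ (fold-map-∙ g h xs)) (interchange _ _ _ _)

  fold-words-suc : ∀ (h : Word → Carrier) n →
                   fold (map h (words (suc n)))
                     ≈ fold (map (λ w → h (a ∷ w)) (words n)) ∙ fold (map (λ w → h (b ∷ w)) (words n))
  fold-words-suc h n = split (words n)
    where
    split : ∀ ws → fold (map h (concatMap (λ w → (a ∷ w) ∷ (b ∷ w) ∷ []) ws))
                     ≈ fold (map (λ w → h (a ∷ w)) ws) ∙ fold (map (λ w → h (b ∷ w)) ws)
    split []       = sym (identityˡ ε)
    split (w ∷ ws) =
      trans (∙-congˡ (∙-congˡ (split ws))) (trans (sym (assoc _ _ _)) (interchange _ _ _ _))

  fold-words≈treeFold : ∀ n g y {h : Word → Carrier} → (∀ w → h w ≡ g (y ++ w)) →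
                        fold (map h (words n)) ≈ treeFold n g y
  fold-words≈treeFold zero    g y h≗ =
    trans (identityʳ _) (reflexive (≡.trans (h≗ []) (≡.cong g (++-identityʳ y))))
  fold-words≈treeFold (suc n) g y {h} h≗ =
    trans (fold-words-suc h n) (∙-cong (below a) (below b))
    where
    below : ∀ l → fold (map (λ w → h (l ∷ w)) (words n)) ≈ treeFold n g (y ∷ʳ l)
    below l = fold-words≈treeFold n g (y ∷ʳ l)
                (λ w → ≡.trans (h≗ (l ∷ w)) (≡.cong g (≡.sym (∷ʳ-++ y l w))))

module XorFold = TreeFold (CommutativeRing.+-commutativeMonoid xor-∧-commutativeRing)

module _ {c ℓ : Level} (L : CommutativeRing c ℓ) where
  open CommutativeRing L
  open FT L
  open import Algebra.Properties.Ring ring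
  open import Algebra.Definitions _≈_ using (AlmostRightCancellative)
  open import Relation.Binary.Reasoning.Setoid setoid
  module Π = TreeFold *-commutativeMonoid

  signed-cong : ∀ p {x y} → x ≈ y → signed p x ≈ signed p y
  signed-cong false x≈y = x≈y
  signed-cong true  x≈y = -‿cong x≈y

  signed-involutive : ∀ p x → signed p (signed p x) ≈ x
  signed-involutive false x = refl
  signed-involutive true  x = -‿involutive x

  signed-signed : ∀ p q x → signed p (signed q x) ≈ signed (p xor q) x
  signed-signed false q     x = refl
  signed-signed true  false x = refl
  signed-signed true  true  x = -‿involutive x

  signed-*ˡ : ∀ p x y → signed p x * y ≈ signed p (x * y)
  signed-*ˡ false x y = refl
  signed-*ˡ true  x y = sym (-‿distribˡ-* x y)

  signed-*ʳ : ∀ p x y → x * signed p y ≈ signed p (x * y)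
  signed-*ʳ false x y = refl
  signed-*ʳ true  x y = sym (-‿distribʳ-* x y)

  signed-*-signed : ∀ p q x y → signed p x * signed q y ≈ signed (p xor q) (x * y)
  signed-*-signed p q x y = begin
    signed p x * signed q y       ≈⟨ signed-*ˡ p x _ ⟩
    signed p (x * signed q y)     ≈⟨ signed-cong p (signed-*ʳ q x y) ⟩
    signed p (signed q (x * y))   ≈⟨ signed-signed p q _ ⟩
    signed (p xor q) (x * y)      ∎

  signed-+-signed : ∀ p q x y → signed p x + signed q y ≈ signed q (signed (p xor q) x + y)
  signed-+-signed false false x y = refl
  signed-+-signed true  false x y = refl
  signed-+-signed false true  x y = begin
    x + - y          ≈⟨ +-congʳ (-‿involutive x) ⟨
    - - x + - y      ≈⟨ -‿+-comm (- x) y ⟩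
    - (- x + y)      ∎
  signed-+-signed true  true  x y = -‿+-comm x y

  flipIf-children-* : ∀ (f : Letter → Carrier) p → f (flipIf p a) * f (flipIf p b) ≈ f a * f b
  flipIf-children-* f false = refl
  flipIf-children-* f true  = *-comm _ _

  *≈-≉0ˡ : ∀ {x y z} → x * y ≈ z → ¬ z ≈ 0# → ¬ x ≈ 0#
  *≈-≉0ˡ {x} {y} xy≈z z≉0 x≈0 = z≉0 (trans (sym xy≈z) (trans (*-congʳ x≈0) (zeroˡ y)))

  *≈-≉0ʳ : ∀ {x y z} → x * y ≈ z → ¬ z ≈ 0# → ¬ y ≈ 0#
  *≈-≉0ʳ {x} {y} xy≈z = *≈-≉0ˡ (trans (*-comm y x) xy≈z)

  module FieldFacts (isField : IsField) where

    *-cancelʳ-≉0 : AlmostRightCancellative 0# _*_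
    *-cancelʳ-≉0 z x y z≉0 xz≈yz with proj₂ isField z z≉0
    ... | z⁻¹ , zz⁻¹≈1 = begin
      x              ≈⟨ *-identityʳ x ⟨
      x * 1#         ≈⟨ *-congˡ zz⁻¹≈1 ⟨
      x * (z * z⁻¹)  ≈⟨ *-assoc x z z⁻¹ ⟨
      x * z * z⁻¹    ≈⟨ *-congʳ xz≈yz ⟩
      y * z * z⁻¹    ≈⟨ *-assoc y z z⁻¹ ⟩
      y * (z * z⁻¹)  ≈⟨ *-congˡ zz⁻¹≈1 ⟩
      y * 1#         ≈⟨ *-identityʳ y ⟩
      y              ∎

    x*y≈0⇒y≈0 : ∀ {x y} → ¬ x ≈ 0# → x * y ≈ 0# → y ≈ 0#
    x*y≈0⇒y≈0 {x} {y} x≉0 xy≈0 =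
      *-cancelʳ-≉0 x y 0# x≉0 (trans (*-comm y x) (trans xy≈0 (sym (zeroˡ x))))

    x≈-x⇒x≈0 : ¬ (1# + 1# ≈ 0#) → ∀ {x} → x ≈ - x → x ≈ 0#
    x≈-x⇒x≈0 2≉0 {x} x≈-x = x*y≈0⇒y≈0 2≉0 (begin
      (1# + 1#) * x     ≈⟨ distribʳ x 1# 1# ⟩
      1# * x + 1# * x   ≈⟨ +-cong (*-identityˡ x) (*-identityˡ x) ⟩
      x + x             ≈⟨ +-congʳ x≈-x ⟩
      - x + x           ≈⟨ -‿inverseˡ x ⟩
      0#                ∎)

    signed-injective : ¬ (1# + 1# ≈ 0#) → ∀ {z} p q → ¬ z ≈ 0# → signed p z ≈ signed q z → p ≡ q
    signed-injective 2≉0 false false z≉0 _ = ≡.refl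
    signed-injective 2≉0 true  true  z≉0 _ = ≡.refl
    signed-injective 2≉0 false true  z≉0 e = ⊥-elim (z≉0 (x≈-x⇒x≈0 2≉0 e))
    signed-injective 2≉0 true  false z≉0 e = ⊥-elim (z≉0 (x≈-x⇒x≈0 2≉0 (sym e)))

    x*x≈y*y⇒x≈-y : ∀ {x y} → x * x ≈ y * y → ¬ x ≈ y → x ≈ - y
    x*x≈y*y⇒x≈-y {x} {y} xx≈yy x≉y = +-inverseˡ-unique x y (x*y≈0⇒y≈0 x-y≉0 (begin
      (x - y) * (x + y)              ≈⟨ [y-z]x≈yx-zx (x + y) x y ⟩
      x * (x + y) - y * (x + y)      ≈⟨ x≈y⇒x∙y⁻¹≈ε x[x+y]≈y[x+y] ⟩
      0#                             ∎))
      where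
      x-y≉0 : ¬ (x - y) ≈ 0#
      x-y≉0 x-y≈0 = x≉y (x∙y⁻¹≈ε⇒x≈y x y x-y≈0)
      x[x+y]≈y[x+y] : x * (x + y) ≈ y * (x + y)
      x[x+y]≈y[x+y] = begin
        x * (x + y)     ≈⟨ distribˡ x x y ⟩
        x * x + x * y   ≈⟨ +-cong xx≈yy (*-comm x y) ⟩
        y * y + y * x   ≈⟨ +-comm _ _ ⟩
        y * x + y * y   ≈⟨ distribˡ y x y ⟨
        y * (x + y)     ∎

  module PreimageTree
    (cc x0 : Carrier) (lab : Word → Carrier) (isLabeling : IsLabeling cc x0 lab) where
    open IsLabeling isLabeling

    f-cong : ∀ {x y} → x ≈ y → fc cc x ≈ fc cc y
    f-cong x≈y = +-congʳ (*-cong x≈y x≈y)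

    iter-cong : ∀ n {x y} → x ≈ y → iter (fc cc) n x ≈ iter (fc cc) n y
    iter-cong zero    x≈y = x≈y
    iter-cong (suc n) x≈y = f-cong (iter-cong n x≈y)

    label-flipLetter : ∀ u l → lab (u ∷ʳ flipLetter l) ≈ - lab (u ∷ʳ l)
    label-flipLetter u a = child-b u
    label-flipLetter u b = trans (sym (-‿involutive _)) (-‿cong (sym (child-b u)))

    label-flipIf : ∀ u p l → lab (u ∷ʳ flipIf p l) ≈ signed p (lab (u ∷ʳ l))
    label-flipIf u false l = refl
    label-flipIf u true  l = label-flipLetter u l

    f-label-∷ʳ : ∀ w l → fc cc (lab (w ∷ʳ l)) ≈ lab w
    f-label-∷ʳ w a = child-a w
    f-label-∷ʳ w b = begin
      fc cc (lab (w ∷ʳ b))                ≈⟨ f-cong (child-b w) ⟩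
      fc cc (- lab (w ∷ʳ a))              ≈⟨ +-congʳ (sym (-‿distribˡ-* _ _)) ⟩
      - (lab (w ∷ʳ a) * - lab (w ∷ʳ a)) + cc ≈⟨ +-congʳ (-‿cong (-‿distribʳ-* _ _)) ⟨
      - - (lab (w ∷ʳ a) * lab (w ∷ʳ a)) + cc ≈⟨ +-congʳ (-‿involutive _) ⟩
      fc cc (lab (w ∷ʳ a))                ≈⟨ child-a w ⟩
      lab w                               ∎

    iter-label-++ : ∀ w v → iter (fc cc) (length v) (lab (w ++ v)) ≈ lab w
    iter-label-++ w []      = reflexive (≡.cong lab (++-identityʳ w))
    iter-label-++ w (l ∷ v) = begin
      fc cc (iter (fc cc) (length v) (lab (w ++ l ∷ v)))
        ≡⟨ ≡.cong (λ u → fc cc (iter (fc cc) (length v) (lab u))) (∷ʳ-++ w l v) ⟨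
      fc cc (iter (fc cc) (length v) (lab (w ∷ʳ l ++ v)))
        ≈⟨ f-cong (iter-label-++ (w ∷ʳ l) v) ⟩
      fc cc (lab (w ∷ʳ l))
        ≈⟨ f-label-∷ʳ w l ⟩
      lab w ∎

    label≉0 : (∀ i → ¬ x0 ≈ iter (fc cc) i 0#) → ∀ w → ¬ lab w ≈ 0#
    label≉0 x0∉orbit w [w]≈0 = x0∉orbit (length w) (begin
      x0                                  ≈⟨ root ⟨
      lab []                              ≈⟨ iter-label-++ [] w ⟨
      iter (fc cc) (length w) (lab w)     ≈⟨ iter-cong (length w) [w]≈0 ⟩
      iter (fc cc) (length w) 0#          ∎)

  module GaloisAction
    (K : Subfield) (cc : Carrier) (cc∈K : Subfield.InK K cc)
    (x0 : Carrier) (lab : Word → Carrier) (isLabeling : IsLabeling cc x0 lab)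
    (σ : (x : Carrier) → InK∞ K lab x → Carrier) (isGal : IsGalElt K lab σ)
    (act : Word → Word) (induces : Induces K lab σ act) (isField : IsField)
    where
    open IsLabeling isLabeling
    open IsGalElt isGal renaming (cong to σ-cong)
    open PreimageTree cc x0 lab isLabeling
    open FieldFacts isField

    σ-0 : ∀ p → σ 0# p ≈ 0#
    σ-0 p = x+x≈x⇒x≈0 (σ 0# p)
      (trans (sym (hom-+ 0# 0# p p (add p p))) (σ-cong _ _ (add p p) p (+-identityˡ 0#)))

    σ-neg : ∀ x p q → σ (- x) q ≈ - σ x p
    σ-neg x p q = +-inverseˡ-unique (σ (- x) q) (σ x p)
      (trans (sym (hom-+ (- x) x q p (add q p)))
        (trans (σ-cong _ 0# (add q p) (base (Subfield.zero∈ K)) (-‿inverseˡ x)) (σ-0 _)))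

    σ-f : ∀ z p q → σ (fc cc z) p ≈ fc cc (σ z q)
    σ-f z p q = trans (hom-+ (z * z) cc (mul q q) (base cc∈K) p)
      (+-cong (hom-* z z q q (mul q q)) (fixK cc cc∈K (base cc∈K)))

    σ-label : ∀ w → σ (lab w) (label w) ≈ lab (act w)
    σ-label w = sym (proj₂ (induces w))

    length-act-∷ʳ : ∀ w l l′ → length (act (w ∷ʳ l)) ≡ length (act w ∷ʳ l′)
    length-act-∷ʳ w l l′ =
      ≡.trans (proj₁ (induces (w ∷ʳ l))) (≡.trans (length-++ w)
        (≡.trans (≡.cong (Nat._+ 1) (≡.sym (proj₁ (induces w)))) (≡.sym (length-++ (act w)))))

    f-label-act-∷ʳ : ∀ w → fc cc (lab (act (w ∷ʳ a))) ≈ lab (act w)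
    f-label-act-∷ʳ w = begin
      fc cc (lab (act (w ∷ʳ a)))              ≈⟨ f-cong (σ-label (w ∷ʳ a)) ⟨
      fc cc (σ (lab (w ∷ʳ a)) (label _))      ≈⟨ σ-f _ (add (mul (label _) (label _)) (base cc∈K)) _ ⟨
      σ (fc cc (lab (w ∷ʳ a))) _              ≈⟨ σ-cong _ _ _ (label w) (child-a w) ⟩
      σ (lab w) (label w)                     ≈⟨ σ-label w ⟩
      lab (act w)                             ∎

    -- σ permutes the two roots of f(z) = [σ(w)], so a moved child goes to the other root.
    act-∷ʳ-a-moved : ∀ w → ¬ act (w ∷ʳ a) ≡ act w ∷ʳ a → act (w ∷ʳ a) ≡ act w ∷ʳ b
    act-∷ʳ-a-moved w moved = inj _ _ (length-act-∷ʳ w a b)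
      (trans (x*x≈y*y⇒x≈-y same-square (λ e → moved (inj _ _ (length-act-∷ʳ w a a) e)))
             (sym (child-b (act w))))
      where
      same-square : lab (act (w ∷ʳ a)) * lab (act (w ∷ʳ a))
                      ≈ lab (act w ∷ʳ a) * lab (act w ∷ʳ a)
      same-square = +-cancelʳ cc _ _ (trans (f-label-act-∷ʳ w) (sym (child-a (act w))))

    act-∷ʳ-a : ∀ w → act (w ∷ʳ a) ≡ act w ∷ʳ flipIf (Par act w) a
    act-∷ʳ-a w with act (w ∷ʳ a) ≟W (act w ∷ʳ a)
    ... | yes fixed = fixed
    ... | no  moved = act-∷ʳ-a-moved w moved

    act-∷ʳ : ∀ w l → act (w ∷ʳ l) ≡ act w ∷ʳ flipIf (Par act w) l
    act-∷ʳ w a = act-∷ʳ-a w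
    act-∷ʳ w b = inj _ _ (length-act-∷ʳ w b _) (begin
      lab (act (w ∷ʳ b))                         ≈⟨ σ-label (w ∷ʳ b) ⟨
      σ (lab (w ∷ʳ b)) (label _)                 ≈⟨ σ-cong _ _ _ (neg (label _)) (child-b w) ⟩
      σ (- lab (w ∷ʳ a)) _                       ≈⟨ σ-neg _ (label _) _ ⟩
      - σ (lab (w ∷ʳ a)) (label _)               ≈⟨ -‿cong (σ-label (w ∷ʳ a)) ⟩
      - lab (act (w ∷ʳ a))                       ≡⟨ ≡.cong (λ u → - lab u) (act-∷ʳ-a w) ⟩
      - lab (act w ∷ʳ flipIf P a)                ≈⟨ label-flipLetter (act w) (flipIf P a) ⟨
      lab (act w ∷ʳ flipLetter (flipIf P a))     ≡⟨ ≡.cong (λ l → lab (act w ∷ʳ l)) (flipIf-flipLetter P a) ⟨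
      lab (act w ∷ʳ flipIf P b)                  ∎)
      where
      P : Bool
      P = Par act w

    act-∷ʳ-∷ʳ : ∀ x i j →
                act (x ∷ʳ i ∷ʳ j) ≡ act x ∷ʳ flipIf (Par act x) i ∷ʳ flipIf (Par act (x ∷ʳ i)) j
    act-∷ʳ-∷ʳ x i j =
      ≡.trans (act-∷ʳ (x ∷ʳ i) j) (≡.cong (_∷ʳ flipIf (Par act (x ∷ʳ i)) j) (act-∷ʳ x i))

    σ-label-∷ʳ : ∀ w l p → σ (lab (w ∷ʳ l)) p ≈ signed (Par act w) (lab (act w ∷ʳ l))
    σ-label-∷ʳ w l p = begin
      σ (lab (w ∷ʳ l)) p                  ≈⟨ σ-cong _ _ p (label _) refl ⟩
      σ (lab (w ∷ʳ l)) (label _)          ≈⟨ σ-label (w ∷ʳ l) ⟩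
      lab (act (w ∷ʳ l))                  ≡⟨ ≡.cong lab (act-∷ʳ w l) ⟩
      lab (act w ∷ʳ flipIf (Par act w) l) ≈⟨ label-flipIf (act w) (Par act w) l ⟩
      signed (Par act w) (lab (act w ∷ʳ l)) ∎

    -- labelProduct (r - 2) y is the paper's E_y; paritySum n y sums Par(σ, y w) over |w| = n.
    labelProduct : ℕ → Word → Carrier
    labelProduct n = Π.treeFold n (λ u → lab (u ∷ʳ a))

    paritySum : ℕ → Word → Bool
    paritySum n = XorFold.treeFold n (Par act)

    labelProduct∈K∞ : ∀ n y → InK∞ K lab (labelProduct n y)
    labelProduct∈K∞ zero    y = label _
    labelProduct∈K∞ (suc n) y = mul (labelProduct∈K∞ n _) (labelProduct∈K∞ n _)

    σ-labelProduct : ∀ n y p →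
                     σ (labelProduct n y) p ≈ signed (paritySum n y) (labelProduct n (act y))
    σ-labelProduct zero    y p = σ-label-∷ʳ y a p
    σ-labelProduct (suc n) y p = begin
      σ (E′ (y ∷ʳ a) * E′ (y ∷ʳ b)) p
        ≈⟨ hom-* _ _ (labelProduct∈K∞ n _) (labelProduct∈K∞ n _) p ⟩
      σ (E′ (y ∷ʳ a)) _ * σ (E′ (y ∷ʳ b)) _
        ≈⟨ *-cong (σ-labelProduct n (y ∷ʳ a) _) (σ-labelProduct n (y ∷ʳ b) _) ⟩
      signed (S′ (y ∷ʳ a)) (E′ (act (y ∷ʳ a))) * signed (S′ (y ∷ʳ b)) (E′ (act (y ∷ʳ b)))
        ≈⟨ signed-*-signed (S′ (y ∷ʳ a)) (S′ (y ∷ʳ b)) _ _ ⟩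
      signed S (E′ (act (y ∷ʳ a)) * E′ (act (y ∷ʳ b)))
        ≡⟨ ≡.cong₂ (λ u v → signed S (E′ u * E′ v)) (act-∷ʳ y a) (act-∷ʳ y b) ⟩
      signed S (E′ (act y ∷ʳ flipIf (Par act y) a) * E′ (act y ∷ʳ flipIf (Par act y) b))
        ≈⟨ signed-cong S (flipIf-children-* (λ l → E′ (act y ∷ʳ l)) (Par act y)) ⟩
      signed S (labelProduct (suc n) (act y)) ∎
      where
      E′ : Word → Carrier
      E′ = labelProduct n
      S′ : Word → Bool
      S′ = paritySum n
      S : Bool
      S = paritySum (suc n) y

  module Theorem
    (isField : IsField) (K : Subfield) (2≉0 : ¬ (1# + 1# ≈ 0#))
    (cc : Carrier) (cc∈K : Subfield.InK K cc)
    (x0 : Carrier) (x0∉orbit : ∀ i → ¬ (x0 ≈ iter (fc cc) i 0#))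
    (s : Carrier) (s*s≈2 : s * s ≈ 1# + 1#)
    (lab : Word → Carrier) (isLabeling : IsLabeling cc x0 lab)
    (m : ℕ) (hyp : ∀ x → LabelHyp (suc (suc m)) lab s x)
    (σ : (x : Carrier) → InK∞ K lab x → Carrier) (isGal : IsGalElt K lab σ)
    (act : Word → Word) (induces : Induces K lab σ act)
    where
    open IsGalElt isGal renaming (cong to σ-cong)
    open PreimageTree cc x0 lab isLabeling using (label≉0)
    open FieldFacts isField
    open GaloisAction K cc cc∈K x0 lab isLabeling σ isGal act induces isField

    r : ℕ
    r = suc (suc m)

    s≉0 : ¬ s ≈ 0#
    s≉0 s≈0 = 2≉0 (trans (sym s*s≈2) (trans (*-congʳ s≈0) (zeroˡ s)))

    Ex : Word → Letter → Letter → Carrier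
    Ex x i j = labelProduct m (x ∷ʳ i ∷ʳ j)

    Sx : Word → Letter → Letter → Bool
    Sx x i j = paritySum m (x ∷ʳ i ∷ʳ j)

    Ex∈K∞ : ∀ x i j → InK∞ K lab (Ex x i j)
    Ex∈K∞ x i j = labelProduct∈K∞ m _

    E≈Ex : ∀ x i j → E r lab (x ++ i ∷ j ∷ []) ≈ Ex x i j
    E≈Ex x i j = Π.fold-words≈treeFold m _ (x ∷ʳ i ∷ʳ j) λ w →
      ≡.cong lab (≡.trans (≡.cong (_++ w ++ [ a ]) (≡.sym (∷ʳ-++ x i [ j ])))
                          (≡.sym (++-assoc (x ∷ʳ i ∷ʳ j) w [ a ])))

    label≈ : ∀ x i j → lab (x ++ i ∷ j ∷ []) ≈ lab (x ∷ʳ i ∷ʳ j)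
    label≈ x i j = reflexive (≡.cong lab (≡.sym (∷ʳ-++ x i [ j ])))

    Ex-product : ∀ y l → Ex y l a * Ex y l b ≈ lab (y ∷ʳ flipLetter l ∷ʳ a)
    Ex-product y l =
      trans (*-cong (sym (E≈Ex y l a)) (sym (E≈Ex y l b))) (trans (hyp-product l) (label≈ y _ a))
      where
      hyp-product : ∀ l → E r lab (y ++ l ∷ a ∷ []) * E r lab (y ++ l ∷ b ∷ [])
                          ≈ lab (y ++ flipLetter l ∷ a ∷ [])
      hyp-product a = proj₁ (hyp y)
      hyp-product b = proj₁ (proj₂ (hyp y))

    Ex-sum : ∀ y l → Ex y l a + Ex y l b ≈ s * Ex y (flipLetter l) b
    Ex-sum y l =
      trans (+-cong (sym (E≈Ex y l a)) (sym (E≈Ex y l b))) (trans (hyp-sum l) (*-congˡ (E≈Ex y _ b)))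
      where
      hyp-sum : ∀ l → E r lab (y ++ l ∷ a ∷ []) + E r lab (y ++ l ∷ b ∷ [])
                      ≈ s * E r lab (y ++ flipLetter l ∷ b ∷ [])
      hyp-sum a = proj₁ (proj₂ (proj₂ (hyp y)))
      hyp-sum b = proj₁ (proj₂ (proj₂ (proj₂ (proj₂ (hyp y)))))

    Ex-difference : ∀ y l → Ex y l b - Ex y l a ≈ s * Ex y (flipLetter l) a
    Ex-difference y l =
      trans (+-cong (sym (E≈Ex y l b)) (-‿cong (sym (E≈Ex y l a))))
            (trans (hyp-difference l) (*-congˡ (E≈Ex y _ a)))
      where
      hyp-difference : ∀ l → E r lab (y ++ l ∷ b ∷ []) - E r lab (y ++ l ∷ a ∷ [])
                             ≈ s * E r lab (y ++ flipLetter l ∷ a ∷ [])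
      hyp-difference a = proj₁ (proj₂ (proj₂ (proj₂ (hyp y))))
      hyp-difference b = proj₂ (proj₂ (proj₂ (proj₂ (proj₂ (hyp y)))))

    Ex≉0 : ∀ y l j → ¬ Ex y l j ≈ 0#
    Ex≉0 y l a = *≈-≉0ˡ (Ex-product y l) (label≉0 x0∉orbit _)
    Ex≉0 y l b = *≈-≉0ʳ (Ex-product y l) (label≉0 x0∉orbit _)

    -- The four quotient identities at once: which one applies depends on the signs q, t.
    signed-Ex-sum : ∀ y l q t → signed t (Ex y l (flipIf q a)) + Ex y l (flipIf q b)
                                  ≈ signed (q ∧ t) (s * Ex y (flipLetter l) (flipIf t b))
    signed-Ex-sum y l false false = Ex-sum y l
    signed-Ex-sum y l true  false = trans (+-comm _ _) (Ex-sum y l)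
    signed-Ex-sum y l false true  = trans (+-comm _ _) (Ex-difference y l)
    signed-Ex-sum y l true  true  =
      trans (+-comm _ _) (trans (sym (⁻¹-anti-homo‿- _ _)) (-‿cong (Ex-difference y l)))

    σ-Ex : ∀ x i j p → σ (Ex x i j) p
                       ≈ signed (Sx x i j) (Ex (act x) (flipIf (Par act x) i) (flipIf (Par act (x ∷ʳ i)) j))
    σ-Ex x i j p = trans (σ-labelProduct m _ p)
      (reflexive (≡.cong (λ u → signed (Sx x i j) (labelProduct m u)) (act-∷ʳ-∷ʳ x i j)))

    parity-branch : ∀ x i → Par act (x ∷ʳ flipLetter i) ≡ Sx x i a xor Sx x i b
    parity-branch x i = signed-injective 2≉0 Pī Sab (label≉0 x0∉orbit (x′ ∷ʳ flipLetter l ∷ʳ a)) (begin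
      signed Pī (lab (x′ ∷ʳ flipLetter l ∷ʳ a))
        ≡⟨ ≡.cong (λ u → signed Pī (lab (u ∷ʳ a)))
                  (≡.trans (act-∷ʳ x (flipLetter i)) (≡.cong (x′ ∷ʳ_) (flipIf-flipLetter P i))) ⟨
      signed Pī (lab (act (x ∷ʳ flipLetter i) ∷ʳ a))
        ≈⟨ σ-label-∷ʳ (x ∷ʳ flipLetter i) a (label _) ⟨
      σ (lab (x ∷ʳ flipLetter i ∷ʳ a)) (label _)
        ≈⟨ σ-cong _ _ (label _) (mul (Ex∈K∞ x i a) (Ex∈K∞ x i b)) (sym (Ex-product x i)) ⟩
      σ (Ex x i a * Ex x i b) _
        ≈⟨ hom-* _ _ (Ex∈K∞ x i a) (Ex∈K∞ x i b) _ ⟩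
      σ (Ex x i a) _ * σ (Ex x i b) _
        ≈⟨ *-cong (σ-Ex x i a _) (σ-Ex x i b _) ⟩
      signed (Sx x i a) (Ex x′ l (flipIf Q a)) * signed (Sx x i b) (Ex x′ l (flipIf Q b))
        ≈⟨ signed-*-signed (Sx x i a) (Sx x i b) _ _ ⟩
      signed Sab (Ex x′ l (flipIf Q a) * Ex x′ l (flipIf Q b))
        ≈⟨ signed-cong Sab (trans (flipIf-children-* (Ex x′ l) Q) (Ex-product x′ l)) ⟩
      signed Sab (lab (x′ ∷ʳ flipLetter l ∷ʳ a)) ∎)
      where
      x′ : Word
      x′ = act x
      P Q Pī Sab : Bool
      P = Par act x
      Q = Par act (x ∷ʳ i)
      Pī = Par act (x ∷ʳ flipLetter i)
      Sab = Sx x i a xor Sx x i b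
      l : Letter
      l = flipIf P i

    paritySum-below : ∀ x i → xorSum (map (λ w → Par act (x ++ i ∷ w)) (words (suc m)))
                              ≡ Sx x i a xor Sx x i b
    paritySum-below x i = XorFold.fold-words≈treeFold (suc m) (Par act) (x ∷ʳ i) λ w →
      ≡.cong (Par act) (≡.sym (∷ʳ-++ x i w))

    P-vanishes : ∀ x i → Par act (x ∷ʳ flipLetter i)
                           xor xorSum (map (λ w → Par act (x ++ i ∷ w)) (words (suc m))) ≡ false
    P-vanishes x i = ≡.trans (≡.cong₂ _xor_ (parity-branch x i) (paritySum-below x i))
                             (xor-same (Sx x i a xor Sx x i b))

    Rr≡ : ∀ x → Rr r act x ≡ (Par act (x ∷ʳ a) ∧ Par act (x ∷ʳ b)) xor (Sx x a b xor Sx x b b)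
    Rr≡ x = ≡.cong ((Par act (x ∷ʳ a) ∧ Par act (x ∷ʳ b)) xor_)
      (≡.trans (XorFold.fold-map-∙ (below₁ a) (below₁ b) (words m)) (≡.cong₂ _xor_ (below a) (below b)))
      where
      below₁ : Letter → Word → Bool
      below₁ i w = Par act (x ++ i ∷ b ∷ w)
      below : ∀ i → xorSum (map (below₁ i) (words m)) ≡ Sx x i b
      below i = XorFold.fold-words≈treeFold m (Par act) (x ∷ʳ i ∷ʳ b) λ w →
        ≡.cong (Par act) (≡.sym (∷ʳ-∷ʳ-++ x i b w))

    √2∈K∞ : InK∞ K lab s
    √2∈K∞ with proj₂ isField (Ex [] b b) (Ex≉0 [] b b)
    ... | e⁻¹ , ee⁻¹≈1 =
      resp quotient≈s (mul (add (Ex∈K∞ [] a a) (Ex∈K∞ [] a b)) (inv (Ex∈K∞ [] b b) ee⁻¹≈1))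
      where
      quotient≈s : (Ex [] a a + Ex [] a b) * e⁻¹ ≈ s
      quotient≈s = begin
        (Ex [] a a + Ex [] a b) * e⁻¹   ≈⟨ *-congʳ (Ex-sum [] a) ⟩
        s * Ex [] b b * e⁻¹             ≈⟨ *-assoc s _ e⁻¹ ⟩
        s * (Ex [] b b * e⁻¹)           ≈⟨ *-congˡ ee⁻¹≈1 ⟩
        s * 1#                          ≈⟨ *-identityʳ s ⟩
        s                               ∎

    σ-√2 : ∀ x → σ s √2∈K∞ ≈ signed (Rr r act x) s
    σ-√2 x = *-cancelʳ-≉0 X _ _ (Ex≉0 x′ (flipLetter l) (flipIf T b)) (begin
      σ s √2∈K∞ * X                                   ≈⟨ signed-involutive Sbb _ ⟨
      signed Sbb (signed Sbb (σ s √2∈K∞ * X))         ≈⟨ signed-cong Sbb (signed-*ʳ Sbb _ X) ⟨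
      signed Sbb (σ s √2∈K∞ * signed Sbb X)           ≈⟨ signed-cong Sbb (*-congˡ σ-Ebb) ⟨
      signed Sbb (σ s _ * σ (Ex x b b) _)             ≈⟨ signed-cong Sbb σ-√2Ebb ⟩
      signed Sbb (signed Sab (signed (Q ∧ T) (s * X))) ≈⟨ signed-cong Sbb (signed-signed Sab (Q ∧ T) _) ⟩
      signed Sbb (signed (Sab xor (Q ∧ T)) (s * X))   ≈⟨ signed-signed Sbb _ _ ⟩
      signed (Sbb xor (Sab xor (Q ∧ T))) (s * X)      ≡⟨ ≡.cong (λ e → signed e (s * X)) exponent ⟩
      signed (Rr r act x) (s * X)                     ≈⟨ signed-*ˡ (Rr r act x) s X ⟨
      signed (Rr r act x) s * X                       ∎)
      where
      x′ : Word
      x′ = act x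
      P Q T Sab Sbb : Bool
      P = Par act x
      Q = Par act (x ∷ʳ a)
      T = Par act (x ∷ʳ b)
      Sab = Sx x a b
      Sbb = Sx x b b
      l : Letter
      l = flipIf P a
      X : Carrier
      X = Ex x′ (flipLetter l) (flipIf T b)
      σ-Ebb : σ (Ex x b b) (Ex∈K∞ x b b) ≈ signed Sbb X
      σ-Ebb = trans (σ-Ex x b b _)
        (reflexive (≡.cong (λ v → signed Sbb (Ex x′ v (flipIf T b))) (flipIf-flipLetter P a)))
      σ-√2Ebb : σ s √2∈K∞ * σ (Ex x b b) (Ex∈K∞ x b b) ≈ signed Sab (signed (Q ∧ T) (s * X))
      σ-√2Ebb = begin
        σ s _ * σ (Ex x b b) _
          ≈⟨ hom-* _ _ _ _ (mul √2∈K∞ (Ex∈K∞ x b b)) ⟨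
        σ (s * Ex x b b) _
          ≈⟨ σ-cong _ _ _ (add (Ex∈K∞ x a a) (Ex∈K∞ x a b)) (sym (Ex-sum x a)) ⟩
        σ (Ex x a a + Ex x a b) _
          ≈⟨ hom-+ _ _ (Ex∈K∞ x a a) (Ex∈K∞ x a b) _ ⟩
        σ (Ex x a a) _ + σ (Ex x a b) _
          ≈⟨ +-cong (σ-Ex x a a _) (σ-Ex x a b _) ⟩
        signed (Sx x a a) (Ex x′ l (flipIf Q a)) + signed Sab (Ex x′ l (flipIf Q b))
          ≈⟨ signed-+-signed (Sx x a a) Sab _ _ ⟩
        signed Sab (signed (Sx x a a xor Sab) (Ex x′ l (flipIf Q a)) + Ex x′ l (flipIf Q b))
          ≡⟨ ≡.cong (λ e → signed Sab (signed e (Ex x′ l (flipIf Q a)) + Ex x′ l (flipIf Q b)))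
                    (parity-branch x a) ⟨
        signed Sab (signed T (Ex x′ l (flipIf Q a)) + Ex x′ l (flipIf Q b))
          ≈⟨ signed-cong Sab (signed-Ex-sum x′ l Q T) ⟩
        signed Sab (signed (Q ∧ T) (s * X)) ∎
      exponent : Sbb xor (Sab xor (Q ∧ T)) ≡ Rr r act x
      exponent = ≡.trans (xor-comm Sbb _) (≡.trans (≡.cong (_xor Sbb) (xor-comm Sab (Q ∧ T)))
                   (≡.trans (xor-assoc (Q ∧ T) Sab Sbb) (≡.sym (Rr≡ x))))

    inB : InB r act
    inB x = P-vanishes x a , P-vanishes x b

    Rr-constant : ∀ x y → Rr r act x ≡ Rr r act y
    Rr-constant x y = signed-injective 2≉0 _ _ s≉0 (trans (sym (σ-√2 x)) (σ-√2 y))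

    √2∈K⇒Rr≡false : Subfield.InK K s → ∀ x → Rr r act x ≡ false
    √2∈K⇒Rr≡false s∈K x = signed-injective 2≉0 _ _ s≉0 (trans (sym (σ-√2 x)) (fixK s s∈K √2∈K∞))

theorem5p6 : ∀ {c ℓ : Level} (L : CommutativeRing c ℓ) →
    let open CommutativeRing L
        open FT L
    in IsField →
    (K : Subfield) → IsAlgClosureOf K →
    ¬ (1# + 1# ≈ 0#) →
    (cc : Carrier) → Subfield.InK K cc →
    (∀ n → ¬ (iter (fc cc) (suc n) 0# ≈ 0#)) →
    (r : ℕ) → 3 ≤ r →
    iter (fc cc) r 0# ≈ - fc cc 0# →
    (∀ k → 1 < k → k < r → ¬ (iter (fc cc) k 0# ≈ - fc cc 0#)) →
    (x0 : Carrier) → Subfield.InK K x0 →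
    (∀ i → ¬ (x0 ≈ iter (fc cc) i 0#)) →
    (s : Carrier) → s * s ≈ 1# + 1# →
    (lab : Word → Carrier) → IsLabeling cc x0 lab →
    (∀ x → LabelHyp r lab s x) →
    (σ : (x : Carrier) → InK∞ K lab x → Carrier) → IsGalElt K lab σ →
    (act : Word → Word) → Induces K lab σ act →
    (∀ x → Pa r act x ≡ false × Pb r act x ≡ false
    × Σ (InK∞ K lab s) (λ p → σ s p ≈ signed (Rr r act x) s))
    × InMt r act
    × (Subfield.InK K s → InBt r act)
-- Of the hypotheses on c, r and x0, the argument only needs r ≥ 2 and x0 outside the
-- orbit of 0 (no label vanishes); the others serve the existence of the labeling.
theorem5p6 L isField K _ 2≉0 cc cc∈K _ (suc (suc m)) (s≤s (s≤s _)) _ _ x0 _ x0∉orbit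
           s s*s≈2 lab isLabeling hyp σ isGal act induces =
    (λ x → P-vanishes x a , P-vanishes x b , √2∈K∞ , σ-√2 x)
  , (inB , Rr r act [] , λ x → Rr-constant x [])
  , λ s∈K → inB , √2∈K⇒Rr≡false s∈K
  where
  open Theorem L isField K 2≉0 cc cc∈K x0 x0∉orbit s s*s≈2 lab isLabeling m hyp
                σ isGal act induces
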